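{- Let $n\in\mathbb{N}$ be arbitrary. If $k\in\mathbb{N}$ satisfies $\frac{2}{3}n\leq k\leq n$, then $f_k(n)=kn$.
   Context: For positive integers $n,k$, $f_k(n)$ denotes the maximum size of a set of points chosen from the $n\times n$ grid $\{1,\dots,n\}\times\{1,\dots,n\}\subseteq\mathbb{Z}^2$ such that at most $k$ of the chosen points lie on any line of the Euclidean plane. -}

module Defs where

open import Data.Nat using (ℕ; suc; _≤_)
open import Data.Fin using (Fin; toℕ)
open import Data.Integer using (ℤ; +_; _+_; _*_; _≟_)
open import Data.Product using (_×_; _,_; ∃)
open import Data.List using (List; length; filter)
open import Data.List.Relation.Unary.Unique.Propositional using (Unique)
open import Relation.Binary.PropositionalEquality using (_≡_)
open import Relation.Nullary using (¬_; Dec)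

-- A point of the n×n grid {1,…,n}×{1,…,n}; the Fin index i stands for coordinate i+1.
Point : ℕ → Set
Point n = Fin n × Fin n

coord : ∀ {n} → Fin n → ℤ
coord i = + suc (toℕ i)

-- Every Euclidean line through ≥ 2 grid points is of this form, and every
-- single grid point lies on such a line, so "at most k chosen points on any
-- line of the plane" is equivalent to the same condition over these lines.
record Line : Set where
  constructor line
  field
    a b c : ℤ
    nondeg : ¬ (a ≡ + 0 × b ≡ + 0)

OnLine : ∀ {n} → Line → Point n → Set
OnLine L (i , j) = Line.a L * coord i + Line.b L * coord j ≡ Line.c L

onLine? : ∀ {n} (L : Line) (p : Point n) → Dec (OnLine L p)
onLine? L (i , j) = Line.a L * coord i + Line.b L * coord j ≟ Line.c L

Admissible : (n k : ℕ) → List (Point n) → Set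
Admissible n k S = Unique S × (∀ (L : Line) → length (filter (onLine? L) S) ≤ k)

IsFkn : (k n m : ℕ) → Set
IsFkn k n m =
  (∃ λ (S : List (Point n)) → Admissible n k S × length S ≡ m)
  × (∀ (S : List (Point n)) → Admissible n k S → length S ≤ m)

{-# OPTIONS --safe #-}
module Submission where

-- Upper bound: each of the n rows is a line, so it holds at most k chosen points.
--
-- Lower bound (k ≥ 1): put m = n - k, so that 2m ≤ k. Let Mid be the band of m consecutive
-- coordinates starting at ⌊k/2⌋, and number the k coordinates outside it 0, …, k - 1 (collapse).
-- Choose (x, y) when exactly one of x, y lies in Mid, or when neither does and
-- collapse x + collapse y + 1 is at least m modulo k; the choice is symmetric and every row
-- holds exactly k points. A line of slope other than 0, ±1, ∞ meets each pair of adjacent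
-- columns (or rows) at most once, hence holds at most ⌈n/2⌉ ≤ k points. On the lines of
-- slope ±1 the empty square Mid × Mid removes enough points, except on the antidiagonals
-- x + y = s with n ≤ s + 1 < n + m; there the rotation modulo k chooses no point outside the
-- rows and columns of Mid, which leaves at most 2m ≤ k points.

open import Defs
open import Data.Nat using (ℕ; _*_; _≤_)

open import Data.Nat using (NonZero; suc; _+_; _∸_; _<_; _<?_; _≤?_; z≤n; s≤s; s≤s⁻¹; ⌊_/2⌋; ⌈_/2⌉)
open import Data.Nat.Properties
open import Data.Nat.DivMod
  using (_%_; %-distribˡ-+; m%n%n≡m%n; [m+n]%n≡m%n; m<n⇒m%n≡m; m≤n⇒[n∸m]%m≡n%m; m%n<n)
open import Data.Nat.Tactic.RingSolver using (solve-∀)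
open import Data.Integer as ℤ using (ℤ; +_; +0; -[1+_]; -_; _-_; ∣_∣)
import Data.Integer.Properties as ℤ
import Data.Integer.Tactic.RingSolver as ℤ-Solver
open import Algebra.Properties.AbelianGroup ℤ.+-0-abelianGroup using (∙-cancelˡ)
open import Data.Fin as Fin using (Fin; toℕ; fromℕ<; inject≤; combine)
open import Data.Fin.Properties
  using ( toℕ<n; toℕ-fromℕ<; toℕ-injective; injective⇒≤; fromℕ<-injective; inject≤-injective
        ; combine-injectiveˡ; combine-injectiveʳ)
open import Data.List using (List; []; _∷_; length; lookup; filter; map; allFin; cartesianProductWith)
open import Data.List.Properties using (length-++; length-map; length-tabulate)
open import Data.List.Membership.Propositional using (_∈_)
open import Data.List.Membership.Propositional.Properties
  using (∈-lookup; ∈-filter⁺; ∈-filter⁻; ∈-cartesianProductWith⁻)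
open import Data.List.Relation.Unary.All as All using (_∷_)
open import Data.List.Relation.Unary.Any as Any using ()
open import Data.List.Relation.Unary.Any.Properties using (lookup-index)
open import Data.List.Relation.Unary.AllPairs using ([]; _∷_)
open import Data.List.Relation.Unary.Unique.Propositional using (Unique)
import Data.List.Relation.Unary.Unique.Propositional.Properties as Unique
open import Data.Product using (_×_; _,_; proj₁; proj₂; swap; ∃)
open import Data.Sum using (_⊎_; inj₁; inj₂)
open import Data.Empty using (⊥-elim)
open import Function using (Injective; id; _∘_)
open import Relation.Nullary using (¬_; yes; no; contradiction)
open import Relation.Nullary.Decidable using (_×-dec_)
open import Relation.Unary using (Decidable; _∩_)
open import Relation.Binary.Definitions using (tri<; tri≈; tri>)
open import Relation.Binary.PropositionalEquality

-- Counting by injections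

record AtMost {A : Set} (N : ℕ) (P : A → Set) : Set where
  constructor atMost
  field
    index           : ∀ {x} → P x → Fin N
    index-injective : ∀ {x y} (px : P x) (py : P y) → index px ≡ index py → x ≡ y

module _ {A : Set} {N : ℕ} {P : A → Set} where

  atMostℕ : (f : ∀ {x} → P x → ℕ) → (∀ {x} (px : P x) → f px < N) →
            (∀ {x y} (px : P x) (py : P y) → f px ≡ f py → x ≡ y) → AtMost N P
  atMostℕ f f<N f-injective = atMost (λ px → fromℕ< (f<N px))
    (λ px py eq → f-injective px py (fromℕ<-injective _ _ (f<N px) (f<N py) eq))

  AtMost-comap : ∀ {B : Set} {Q : B → Set} (g : A → B) → Injective _≡_ _≡_ g →
                 (∀ {x} → P x → Q (g x)) → AtMost N Q → AtMost N P
  AtMost-comap g g-injective P⇒Q (atMost index index-injective) =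
    atMost (index ∘ P⇒Q) (λ px py eq → g-injective (index-injective (P⇒Q px) (P⇒Q py) eq))

lookup-injective : ∀ {A : Set} {xs : List A} → Unique xs → Injective _≡_ _≡_ (lookup xs)
lookup-injective (_ ∷ _)   {Fin.zero}  {Fin.zero}  _  = refl
lookup-injective (x∉ ∷ _)  {Fin.zero}  {Fin.suc j} eq = ⊥-elim (All.lookup x∉ (∈-lookup j) eq)
lookup-injective (x∉ ∷ _)  {Fin.suc i} {Fin.zero}  eq = ⊥-elim (All.lookup x∉ (∈-lookup i) (sym eq))
lookup-injective (_ ∷ xs!) {Fin.suc i} {Fin.suc j} eq = cong Fin.suc (lookup-injective xs! eq)

AtMost⇒length≤ : ∀ {A : Set} {N} {P : A → Set} {xs : List A} →
                 Unique xs → (∀ {x} → x ∈ xs → P x) → AtMost N P → length xs ≤ N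
AtMost⇒length≤ xs! xs⊆P (atMost index index-injective) = injective⇒≤ λ {i} {j} eq →
  lookup-injective xs! (index-injective (xs⊆P (∈-lookup i)) (xs⊆P (∈-lookup j)) eq)

length≤-by-element : ∀ {A : Set} {xs : List A} {N} → (∀ {x} → x ∈ xs → length xs ≤ N) → length xs ≤ N
length≤-by-element {xs = []}    _      = z≤n
length≤-by-element {xs = _ ∷ _} bound = bound (Any.here refl)

length-cartesianProductWith : ∀ {A B C : Set} (f : A → B → C) xs ys →
                              length (cartesianProductWith f xs ys) ≡ length xs * length ys
length-cartesianProductWith f []       ys = refl
length-cartesianProductWith f (x ∷ xs) ys = trans (length-++ (map (f x) ys))
  (cong₂ _+_ (length-map (f x) ys) (length-cartesianProductWith f xs ys))

-- The upper bound

rowLine : ∀ {n} → Fin n → Line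
rowLine j = line +0 (+ 1) (coord j) λ ()

onRowLine : ∀ {n} (i j : Fin n) → OnLine (rowLine j) (i , j)
onRowLine i j = trans (ℤ.+-identityˡ _) (ℤ.*-identityˡ (coord j))

-- S injects into Fin n × Fin k: a point goes to its row and its position among the points
-- of S in that row.
Admissible⇒length≤ : ∀ {n k} {S : List (Point n)} → Admissible n k S → length S ≤ k * n
Admissible⇒length≤ {n} {k} {S} (S! , S-lines) =
  subst (length S ≤_) (*-comm n k) (AtMost⇒length≤ S! id (atMost position position-injective))
  where
  inRow : ∀ {i j} → (i , j) ∈ S → (i , j) ∈ filter (onLine? (rowLine j)) S
  inRow {i} {j} p∈S = ∈-filter⁺ (onLine? (rowLine j)) p∈S (onRowLine i j)

  position : ∀ {p} → p ∈ S → Fin (n * k)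
  position {_ , j} p∈S = combine j (inject≤ (Any.index (inRow p∈S)) (S-lines (rowLine j)))

  position-injective : ∀ {p q} (p∈S : p ∈ S) (q∈S : q ∈ S) → position p∈S ≡ position q∈S → p ≡ q
  position-injective {i , j} {i' , j'} p∈S q∈S eq with combine-injectiveˡ j _ j' _ eq
  ... | refl = begin
    (i , j)                            ≡⟨ lookup-index (inRow p∈S) ⟩
    lookup row (Any.index (inRow p∈S)) ≡⟨ cong (lookup row) same-index ⟩
    lookup row (Any.index (inRow q∈S)) ≡⟨ lookup-index (inRow q∈S) ⟨
    (i' , j)                           ∎
    where
    open ≡-Reasoning
    row : List (Point n)
    row = filter (onLine? (rowLine j)) S
    same-index : Any.index (inRow p∈S) ≡ Any.index (inRow q∈S)
    same-index = inject≤-injective _ _ _ _ (combine-injectiveʳ j _ j _ eq)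

-- Lines through grid points

coords : ∀ {n} → Point n → ℕ × ℕ
coords (i , j) = toℕ i , toℕ j

coords-injective : ∀ {n} → Injective _≡_ _≡_ (coords {n})
coords-injective {x = _ , _} {_ , _} eq =
  cong₂ _,_ (toℕ-injective (cong proj₁ eq)) (toℕ-injective (cong proj₂ eq))

level : ℤ → ℤ → ℕ × ℕ → ℤ
level a b (x , y) = a ℤ.* + x ℤ.+ b ℤ.* + y

-- OnLine on 0-based coordinates: OnLine L p is definitionally OnLineℕ L (coords p).
OnLineℕ : Line → ℕ × ℕ → Set
OnLineℕ L (x , y) = level (Line.a L) (Line.b L) (suc x , suc y) ≡ Line.c L

data Shape : (ℕ × ℕ → Set) → Set₁ where
  horizontal   : ∀ {P} y₀ → (∀ {x y} → P (x , y) → y ≡ y₀) → Shape P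
  diagonal     : ∀ {P} d → (∀ {x y} → P (x , y) → x ≡ y + d) → Shape P
  antidiagonal : ∀ {P} s → (∀ {x y} → P (x , y) → x + y ≡ s) → Shape P
  shallow      : ∀ {P} → (∀ {p q} → P p → P q → ⌊ proj₁ p /2⌋ ≡ ⌊ proj₁ q /2⌋ → p ≡ q) → Shape P
  transposed   : ∀ {P} → Shape (P ∘ swap) → Shape P

onLine-level : ∀ L {p q} → OnLineℕ L p → OnLineℕ L q →
               level (Line.a L) (Line.b L) p ≡ level (Line.a L) (Line.b L) q
onLine-level (line a b c _) {x , y} {x' , y'} on on' = begin
  level a b (x , y)                              ≡⟨ unshift a b (+ x) (+ y) ⟩
  level a b (suc x , suc y) - (a ℤ.+ b)          ≡⟨ cong (_- (a ℤ.+ b)) (trans on (sym on')) ⟩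
  level a b (suc x' , suc y') - (a ℤ.+ b)        ≡⟨ unshift a b (+ x') (+ y') ⟨
  level a b (x' , y')                            ∎
  where
  open ≡-Reasoning
  unshift : ∀ a b X Y → a ℤ.* X ℤ.+ b ℤ.* Y ≡ (a ℤ.* (+ 1 ℤ.+ X) ℤ.+ b ℤ.* (+ 1 ℤ.+ Y)) - (a ℤ.+ b)
  unshift = ℤ-Solver.solve-∀

level-swap : ∀ a b {p q} → level a b p ≡ level a b q → level b a (swap p) ≡ level b a (swap q)
level-swap a b {x , y} {x' , y'} =
  subst₂ _≡_ (ℤ.+-comm (a ℤ.* + x) (b ℤ.* + y)) (ℤ.+-comm (a ℤ.* + x') (b ℤ.* + y'))

*-cancelˡ-ℕ : ∀ {a m n} → a ≢ +0 → a ℤ.* + m ≡ a ℤ.* + n → m ≡ n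
*-cancelˡ-ℕ {a} a≢0 eq = ℤ.+-injective (ℤ.*-cancelˡ-≡ a _ _ {{ℤ.≢-nonZero a≢0}} eq)

horizontal-level : ∀ b {x y x' y'} → b ≢ +0 →
                   level +0 b (x , y) ≡ level +0 b (x' , y') → y ≡ y'
horizontal-level b {y = y} {y' = y'} b≢0 eq =
  *-cancelˡ-ℕ b≢0 (subst₂ _≡_ (ℤ.+-identityˡ (b ℤ.* + y)) (ℤ.+-identityˡ (b ℤ.* + y')) eq)

antidiagonal-level : ∀ a {x y x' y'} → a ≢ +0 →
                     level a a (x , y) ≡ level a a (x' , y') → x + y ≡ x' + y'
antidiagonal-level a {x} {y} {x'} {y'} a≢0 eq = *-cancelˡ-ℕ a≢0
  (subst₂ _≡_ (sym (ℤ.*-distribˡ-+ a (+ x) (+ y))) (sym (ℤ.*-distribˡ-+ a (+ x') (+ y'))) eq)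

diagonal-level : ∀ b {x y x' y'} → b ≢ +0 →
                 level (- b) b (x , y) ≡ level (- b) b (x' , y') → x + y' ≡ x' + y
diagonal-level b {x} {y} {x'} {y'} b≢0 eq = *-cancelˡ-ℕ b≢0 (begin
  b ℤ.* (+ x ℤ.+ + y')              ≡⟨ shift b (+ x) (+ x') (+ y') ⟩
  level (- b) b (x' , y') ℤ.+ bx+bx' ≡⟨ cong (ℤ._+ bx+bx') eq ⟨
  level (- b) b (x , y) ℤ.+ bx+bx'   ≡⟨ unshift b (+ x) (+ x') (+ y) ⟩
  b ℤ.* (+ x' ℤ.+ + y)              ∎)
  where
  open ≡-Reasoning
  bx+bx' : ℤ
  bx+bx' = b ℤ.* + x ℤ.+ b ℤ.* + x'
  shift : ∀ b X X' Y' → b ℤ.* (X ℤ.+ Y') ≡ (- b ℤ.* X' ℤ.+ b ℤ.* Y') ℤ.+ (b ℤ.* X ℤ.+ b ℤ.* X')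
  shift = ℤ-Solver.solve-∀
  unshift : ∀ b X X' Y → (- b ℤ.* X ℤ.+ b ℤ.* Y) ℤ.+ (b ℤ.* X ℤ.+ b ℤ.* X') ≡ b ℤ.* (X' ℤ.+ Y)
  unshift = ℤ-Solver.solve-∀

x+y'≡x'+y⇒x≡y+[x'∸y'] : ∀ {x y x' y'} → x + y' ≡ x' + y → y' ≤ x' → x ≡ y + (x' ∸ y')
x+y'≡x'+y⇒x≡y+[x'∸y'] {x} {y} {x'} {y'} eq y'≤x' = +-cancelʳ-≡ y' x (y + (x' ∸ y')) (begin
  x + y'                   ≡⟨ eq ⟩
  x' + y                   ≡⟨ cong (_+ y) (m∸n+n≡m y'≤x') ⟨
  (x' ∸ y') + y' + y       ≡⟨ rearrange (x' ∸ y') y' y ⟩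
  y + (x' ∸ y') + y'       ∎)
  where
  open ≡-Reasoning
  rearrange : ∀ d u v → d + u + v ≡ v + d + u
  rearrange = solve-∀

∣i∣≡∣j∣⇒i≡j⊎i≡-j : ∀ i j → ∣ i ∣ ≡ ∣ j ∣ → i ≡ j ⊎ i ≡ - j
∣i∣≡∣j∣⇒i≡j⊎i≡-j (+ _)     (+ _)     refl = inj₁ refl
∣i∣≡∣j∣⇒i≡j⊎i≡-j (+ _)     -[1+ _ ]  refl = inj₂ refl
∣i∣≡∣j∣⇒i≡j⊎i≡-j -[1+ _ ]  (+ _)     refl = inj₂ refl
∣i∣≡∣j∣⇒i≡j⊎i≡-j -[1+ _ ]  -[1+ _ ]  refl = inj₁ refl

⌊/2⌋-injective-up-to-1 : ∀ x y → ⌊ x /2⌋ ≡ ⌊ y /2⌋ → x ≡ y ⊎ suc x ≡ y ⊎ x ≡ suc y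
⌊/2⌋-injective-up-to-1 0 0 _ = inj₁ refl
⌊/2⌋-injective-up-to-1 0 1 _ = inj₂ (inj₁ refl)
⌊/2⌋-injective-up-to-1 1 0 _ = inj₂ (inj₂ refl)
⌊/2⌋-injective-up-to-1 1 1 _ = inj₁ refl
⌊/2⌋-injective-up-to-1 (suc (suc x)) (suc (suc y)) eq
  with ⌊/2⌋-injective-up-to-1 x y (suc-injective eq)
... | inj₁ refl        = inj₁ refl
... | inj₂ (inj₁ refl) = inj₂ (inj₁ refl)
... | inj₂ (inj₂ refl) = inj₂ (inj₂ refl)

⌊x/2⌋<N : ∀ {x N} → x < N + N → ⌊ x /2⌋ < N
⌊x/2⌋<N {x} {N} x<N+N = ≰⇒> λ N≤h → <⇒≱ x<N+N (begin
  N + N                   ≤⟨ +-mono-≤ N≤h N≤h ⟩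
  ⌊ x /2⌋ + ⌊ x /2⌋       ≤⟨ +-monoʳ-≤ ⌊ x /2⌋ (⌊n/2⌋≤⌈n/2⌉ x) ⟩
  ⌊ x /2⌋ + ⌈ x /2⌉       ≡⟨ ⌊n/2⌋+⌈n/2⌉≡n x ⟩
  x                       ∎)
  where open ≤-Reasoning

shallow-step : ∀ a b → a ≢ +0 → ∣ a ∣ < ∣ b ∣ → ∀ {x y y'} →
               level a b (x , y) ≢ level a b (suc x , y')
shallow-step a b a≢0 ∣a∣<∣b∣ {x} {y} {y'} eq = not-a-multiple (+ y - + y') bt≡a
  where
  not-a-multiple : ∀ t → b ℤ.* t ≢ a
  not-a-multiple t bt≡a with ∣ t ∣ | ℤ.abs-* b t
  ... | 0     | ∣bt∣≡ = a≢0 (ℤ.∣i∣≡0⇒i≡0 (trans (cong ∣_∣ (sym bt≡a)) (trans ∣bt∣≡ (*-zeroʳ ∣ b ∣))))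
  ... | suc u | ∣bt∣≡ = <⇒≱ ∣a∣<∣b∣
    (subst (∣ b ∣ ≤_) (trans (sym ∣bt∣≡) (cong ∣_∣ bt≡a)) (m≤m*n ∣ b ∣ (suc u)))
  bt≡a : b ℤ.* (+ y - + y') ≡ a
  bt≡a = begin
    b ℤ.* (+ y - + y')                                ≡⟨ difference a b (+ x) (+ y) (+ y') ⟩
    level a b (x , y) - level a b (x , y')            ≡⟨ cong (_- level a b (x , y')) eq ⟩
    level a b (suc x , y') - level a b (x , y')       ≡⟨ step a b (+ x) (+ y') ⟩
    a                                                 ∎
    where
    open ≡-Reasoning
    difference : ∀ a b X Y Y' → b ℤ.* (Y - Y') ≡ (a ℤ.* X ℤ.+ b ℤ.* Y) - (a ℤ.* X ℤ.+ b ℤ.* Y')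
    difference = ℤ-Solver.solve-∀
    step : ∀ a b X Y' → (a ℤ.* (+ 1 ℤ.+ X) ℤ.+ b ℤ.* Y') - (a ℤ.* X ℤ.+ b ℤ.* Y') ≡ a
    step = ℤ-Solver.solve-∀

shallow-level : ∀ a b → a ≢ +0 → ∣ a ∣ < ∣ b ∣ → ∀ {p q} → level a b p ≡ level a b q →
                ⌊ proj₁ p /2⌋ ≡ ⌊ proj₁ q /2⌋ → p ≡ q
shallow-level a b a≢0 ∣a∣<∣b∣ {x , _} {x' , _} eq ⌊x/2⌋≡ with ⌊/2⌋-injective-up-to-1 x x' ⌊x/2⌋≡
... | inj₁ refl        = cong (x ,_) (*-cancelˡ-ℕ b≢0 (∙-cancelˡ (a ℤ.* + x) _ _ eq))
  where
  b≢0 : b ≢ +0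
  b≢0 refl = <⇒≱ ∣a∣<∣b∣ z≤n
... | inj₂ (inj₁ refl) = ⊥-elim (shallow-step a b a≢0 ∣a∣<∣b∣ eq)
... | inj₂ (inj₂ refl) = ⊥-elim (shallow-step a b a≢0 ∣a∣<∣b∣ (sym eq))

shape : ∀ L {p₀} → OnLineℕ L p₀ → Shape (OnLineℕ L)
shape L@(line a b c nondeg) {x₀ , y₀} on₀ with a ℤ.≟ +0 | b ℤ.≟ +0
... | yes refl | yes refl = ⊥-elim (nondeg (refl , refl))
... | yes refl | no b≢0 = horizontal y₀ λ {x} {y} on →
        horizontal-level b {x} {y} {x₀} {y₀} b≢0 (onLine-level L {x , y} {x₀ , y₀} on on₀)
... | no a≢0 | yes refl = transposed (horizontal x₀ λ {y} {x} on →
        horizontal-level a {y} {x} {y₀} {x₀} a≢0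
          (level-swap a +0 {x , y} {x₀ , y₀} (onLine-level L {x , y} {x₀ , y₀} on on₀)))
... | no a≢0 | no b≢0 with <-cmp ∣ a ∣ ∣ b ∣
... | tri< ∣a∣<∣b∣ _ _ = shallow λ on on' → shallow-level a b a≢0 ∣a∣<∣b∣ (onLine-level L on on')
... | tri> _ _ ∣b∣<∣a∣ = transposed (shallow λ on on' →
        shallow-level b a b≢0 ∣b∣<∣a∣ (level-swap a b (onLine-level L on on')))
... | tri≈ _ ∣a∣≡∣b∣ _ with ∣i∣≡∣j∣⇒i≡j⊎i≡-j a b ∣a∣≡∣b∣
... | inj₁ refl = antidiagonal (x₀ + y₀) λ on → antidiagonal-level a a≢0 (onLine-level L on on₀)
... | inj₂ refl with y₀ ≤? x₀
...   | yes y₀≤x₀ = diagonal (x₀ ∸ y₀) λ on →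
        x+y'≡x'+y⇒x≡y+[x'∸y'] (diagonal-level b b≢0 (onLine-level L on on₀)) y₀≤x₀
...   | no  y₀≰x₀ = transposed (diagonal (y₀ ∸ x₀) λ {y} {x} on →
        x+y'≡x'+y⇒x≡y+[x'∸y'] (subst₂ _≡_ (+-comm x₀ y) (+-comm x y₀)
          (diagonal-level b b≢0 (onLine-level L on₀ on))) (<⇒≤ (≰⇒> y₀≰x₀)))

-- Squeezing a band out of the coordinates

Band : ℕ → ℕ → ℕ → Set
Band A G t = A ≤ t × t < A + G

module Squeeze (A G : ℕ) where

  squeeze : ℕ → ℕ
  squeeze t with t <? A
  ... | yes _ = t
  ... | no  _ = t ∸ G

  expand : ℕ → ℕ
  expand u with u <? A
  ... | yes _ = u
  ... | no  _ = u + G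

  ∉Band : ∀ {t} → ¬ Band A G t → t < A ⊎ A + G ≤ t
  ∉Band {t} t∉ with t <? A | t <? A + G
  ... | yes t<A | _         = inj₁ t<A
  ... | no  t≮A | yes t<A+G = contradiction (≮⇒≥ t≮A , t<A+G) t∉
  ... | no  _   | no  t≮A+G = inj₂ (≮⇒≥ t≮A+G)

  squeeze-below : ∀ {t} → t < A → squeeze t ≡ t
  squeeze-below {t} t<A with t <? A
  ... | yes _   = refl
  ... | no  t≮A = contradiction t<A t≮A

  squeeze-above : ∀ {t} → A + G ≤ t → squeeze t + G ≡ t
  squeeze-above {t} A+G≤t with t <? A
  ... | yes t<A = contradiction (m+n≤o⇒m≤o A A+G≤t) (<⇒≱ t<A)
  ... | no  _   = m∸n+n≡m (m+n≤o⇒n≤o A A+G≤t)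

  expand-below : ∀ {u} → u < A → expand u ≡ u
  expand-below {u} u<A with u <? A
  ... | yes _   = refl
  ... | no  u≮A = contradiction u<A u≮A

  expand-above : ∀ {u} → A ≤ u → expand u ≡ u + G
  expand-above {u} A≤u with u <? A
  ... | yes u<A = contradiction A≤u (<⇒≱ u<A)
  ... | no  _   = refl

  squeeze-< : ∀ {N t} → A ≤ N → t < N + G → ¬ Band A G t → squeeze t < N
  squeeze-< {N} {t} A≤N t<N+G t∉ with ∉Band t∉
  ... | inj₁ t<A   = subst (_< N) (sym (squeeze-below t<A)) (<-≤-trans t<A A≤N)
  ... | inj₂ A+G≤t = +-cancelʳ-< G _ N (subst (_< N + G) (sym (squeeze-above A+G≤t)) t<N+G)

  expand-squeeze : ∀ {t} → ¬ Band A G t → expand (squeeze t) ≡ t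
  expand-squeeze {t} t∉ with ∉Band t∉
  ... | inj₁ t<A   = trans (cong expand (squeeze-below t<A)) (expand-below t<A)
  ... | inj₂ A+G≤t = trans (expand-above A≤s) (squeeze-above A+G≤t)
    where
    A≤s : A ≤ squeeze t
    A≤s = +-cancelʳ-≤ G A _ (subst (A + G ≤_) (sym (squeeze-above A+G≤t)) A+G≤t)

  squeeze-injective : ∀ {t t'} → ¬ Band A G t → ¬ Band A G t' → squeeze t ≡ squeeze t' → t ≡ t'
  squeeze-injective t∉ t'∉ eq =
    trans (sym (expand-squeeze t∉)) (trans (cong expand eq) (expand-squeeze t'∉))

  squeeze-expand : ∀ u → squeeze (expand u) ≡ u
  squeeze-expand u with <-≤-connex u A
  ... | inj₁ u<A = trans (cong squeeze (expand-below u<A)) (squeeze-below u<A)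
  ... | inj₂ A≤u = +-cancelʳ-≡ G _ u (trans (cong (λ t → squeeze t + G) (expand-above A≤u))
                                             (squeeze-above (+-monoˡ-≤ G A≤u)))

  expand-∉ : ∀ u → ¬ Band A G (expand u)
  expand-∉ u (A≤e , e<A+G) with <-≤-connex u A
  ... | inj₁ u<A = <⇒≱ (subst (_< A) (sym (expand-below u<A)) u<A) A≤e
  ... | inj₂ A≤u = <⇒≱ e<A+G (subst (A + G ≤_) (sym (expand-above A≤u)) (+-monoˡ-≤ G A≤u))

  expand-< : ∀ {N u} → u < N → expand u < N + G
  expand-< {N} {u} u<N with <-≤-connex u A
  ... | inj₁ u<A = subst (_< N + G) (sym (expand-below u<A)) (<-≤-trans u<N (m≤m+n N G))
  ... | inj₂ A≤u = subst (_< N + G) (sym (expand-above A≤u)) (+-monoˡ-< G u<N)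

Band-mono : ∀ {A G G' t} → G ≤ G' → Band A G t → Band A G' t
Band-mono {A} G≤G' (A≤t , t<A+G) = A≤t , <-≤-trans t<A+G (+-monoʳ-≤ A G≤G')

AtMost-squeeze : ∀ {B : Set} {Q : B → Set} {N} A G (f : B → ℕ) → A ≤ N →
                 (∀ {p} → Q p → f p < N + G) → (∀ {p} → Q p → ¬ Band A G (f p)) →
                 (∀ {p q} → Q p → Q q → f p ≡ f q → p ≡ q) → AtMost N Q
AtMost-squeeze A G f A≤N f< f∉ f-injective = atMostℕ (λ {p} _ → squeeze (f p))
  (λ Qp → squeeze-< A≤N (f< Qp) (f∉ Qp))
  (λ Qp Qq eq → f-injective Qp Qq (squeeze-injective (f∉ Qp) (f∉ Qq) eq))
  where open Squeeze A G

-- The construction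

[[u+c]%k+d]%k≡u : ∀ {k c d u} .{{_ : NonZero k}} → c + d ≡ k → u < k → ((u + c) % k + d) % k ≡ u
[[u+c]%k+d]%k≡u {k} {c} {d} {u} c+d≡k u<k = begin
  ((u + c) % k + d) % k          ≡⟨ %-distribˡ-+ ((u + c) % k) d k ⟩
  ((u + c) % k % k + d % k) % k  ≡⟨ cong (λ r → (r + d % k) % k) (m%n%n≡m%n (u + c) k) ⟩
  ((u + c) % k + d % k) % k      ≡⟨ %-distribˡ-+ (u + c) d k ⟨
  (u + c + d) % k                ≡⟨ cong (_% k) (trans (+-assoc u c d) (cong (_+_ u) c+d≡k)) ⟩
  (u + k) % k                    ≡⟨ [m+n]%n≡m%n u k ⟩
  u % k                          ≡⟨ m<n⇒m%n≡m u<k ⟩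
  u                              ∎
  where open ≡-Reasoning

w%k<m : ∀ {k m w} .{{_ : NonZero k}} → m ≤ k → k ≤ w → w < k + m → w % k < m
w%k<m {k} {m} {w} m≤k k≤w w<k+m =
  subst (_< m) (trans (sym (m<n⇒m%n≡m w∸k<k)) (m≤n⇒[n∸m]%m≡n%m k≤w)) w∸k<m
  where
  w∸k<m : w ∸ k < m
  w∸k<m = +-cancelˡ-< k _ m (subst (_< k + m) (sym (m+[n∸m]≡n k≤w)) w<k+m)
  w∸k<k : w ∸ k < k
  w∸k<k = <-≤-trans w∸k<m m≤k

module Construction (k m a : ℕ) .{{_ : NonZero k}}
  (m+m≤k : m + m ≤ k) (a+a≤k : a + a ≤ k) (k≤1+a+a : k ≤ suc (a + a)) where

  n : ℕ
  n = k + m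

  Mid : ℕ → Set
  Mid = Band a m

  mid? : Decidable Mid
  mid? x = a ≤? x ×-dec x <? a + m

  open Squeeze a m
    using (expand; expand-<; expand-∉; squeeze-<; squeeze-expand; squeeze-injective)
    renaming (squeeze to collapse; squeeze-below to collapse-below; squeeze-above to collapse-above; ∉Band to ∉Mid)

  cycle : ℕ → ℕ → ℕ
  cycle x y = suc (collapse x + collapse y) % k

  data Chosen : ℕ × ℕ → Set where
    mid-row    : ∀ {x y} → ¬ Mid x → Mid y → Chosen (x , y)
    mid-column : ∀ {x y} → Mid x → ¬ Mid y → Chosen (x , y)
    off-mid    : ∀ {x y} → ¬ Mid x → ¬ Mid y → m ≤ cycle x y → Chosen (x , y)

  Picked : ℕ × ℕ → Set
  Picked (x , y) = x < n × y < n × Chosen (x , y)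

  a≤k : a ≤ k
  a≤k = ≤-trans (m≤m+n a a) a+a≤k

  m≤k : m ≤ k
  m≤k = ≤-trans (m≤m+n m m) m+m≤k

  collapse-< : ∀ {x} → x < n → ¬ Mid x → collapse x < k
  collapse-< = squeeze-< a≤k

  ∸a-< : ∀ {x} → Mid x → x ∸ a < m
  ∸a-< (a≤x , x<a+m) = +-cancelˡ-< a _ m (subst (_< a + m) (sym (m+[n∸m]≡n a≤x)) x<a+m)

  cycle-comm : ∀ x y → cycle x y ≡ cycle y x
  cycle-comm x y = cong (λ s → suc s % k) (+-comm (collapse x) (collapse y))

  Chosen-swap : ∀ {p} → Chosen p → Chosen (swap p)
  Chosen-swap (mid-row ¬Mx My)              = mid-column My ¬Mx
  Chosen-swap (mid-column Mx ¬My)           = mid-row ¬My Mx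
  Chosen-swap {x , y} (off-mid ¬Mx ¬My m≤c) = off-mid ¬My ¬Mx (subst (m ≤_) (cycle-comm x y) m≤c)

  Chosen⇒¬Mid² : ∀ {x y} → Chosen (x , y) → ¬ (Mid x × Mid y)
  Chosen⇒¬Mid² (mid-row ¬Mx _)    (Mx , _)  = ¬Mx Mx
  Chosen⇒¬Mid² (mid-column _ ¬My) (_ , My)  = ¬My My
  Chosen⇒¬Mid² (off-mid ¬Mx _ _)  (Mx , _)  = ¬Mx Mx

  Picked-swap : ∀ {p} → Picked p → Picked (swap p)
  Picked-swap (x<n , y<n , c) = y<n , x<n , Chosen-swap c

  rank : ∀ {x y} → Chosen (x , y) → ℕ
  rank {x}     (mid-row _ _)    = collapse x
  rank {x}     (mid-column _ _) = x ∸ a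
  rank {x} {y} (off-mid _ _ _)  = cycle x y

  rank-< : ∀ {x y} → x < n → (c : Chosen (x , y)) → rank c < k
  rank-< x<n       (mid-row ¬Mx _)   = collapse-< x<n ¬Mx
  rank-< _         (mid-column Mx _) = <-≤-trans (∸a-< Mx) m≤k
  rank-< {x} {y} _ (off-mid _ _ _) = m%n<n (suc (collapse x + collapse y)) k

  rank-cong : ∀ {x x' y} → x ≡ x' → (c : Chosen (x , y)) (c' : Chosen (x' , y)) → rank c ≡ rank c'
  rank-cong refl (mid-row _ _)      (mid-row _ _)      = refl
  rank-cong refl (mid-column _ _)   (mid-column _ _)   = refl
  rank-cong refl (off-mid _ _ _)    (off-mid _ _ _)    = refl
  rank-cong refl (mid-row _ My)     (mid-column _ ¬My) = contradiction My ¬My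
  rank-cong refl (mid-row _ My)     (off-mid _ ¬My _)  = contradiction My ¬My
  rank-cong refl (mid-column _ ¬My) (mid-row _ My)     = contradiction My ¬My
  rank-cong refl (mid-column Mx _)  (off-mid ¬Mx _ _)  = contradiction Mx ¬Mx
  rank-cong refl (off-mid _ ¬My _)  (mid-row _ My)     = contradiction My ¬My
  rank-cong refl (off-mid ¬Mx _ _)  (mid-column Mx _)  = contradiction Mx ¬Mx

  uncycle : ℕ → ℕ → ℕ
  uncycle y r = (r + (k ∸ suc (collapse y))) % k

  uncycle-cycle : ∀ {x y} → x < n → ¬ Mid x → y < n → ¬ Mid y → uncycle y (cycle x y) ≡ collapse x
  uncycle-cycle {x} {y} x<n ¬Mx y<n ¬My = begin
    uncycle y (suc (collapse x + collapse y) % k)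
      ≡⟨ cong (λ s → uncycle y (s % k)) (+-suc (collapse x) (collapse y)) ⟨
    uncycle y ((collapse x + suc (collapse y)) % k)
      ≡⟨ [[u+c]%k+d]%k≡u (m+[n∸m]≡n (collapse-< y<n ¬My)) (collapse-< x<n ¬Mx) ⟩
    collapse x
      ∎
    where open ≡-Reasoning

  cycle-uncycle : ∀ {y i} → y < n → ¬ Mid y → i < k → cycle (expand (uncycle y i)) y ≡ i
  cycle-uncycle {y} {i} y<n ¬My i<k = begin
    suc (collapse (expand (uncycle y i)) + collapse y) % k
      ≡⟨ cong (λ u → suc (u + collapse y) % k) (squeeze-expand (uncycle y i)) ⟩
    suc (uncycle y i + collapse y) % k
      ≡⟨ cong (_% k) (+-suc (uncycle y i) (collapse y)) ⟨
    (uncycle y i + suc (collapse y)) % k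
      ≡⟨ [[u+c]%k+d]%k≡u (m∸n+n≡m (collapse-< y<n ¬My)) i<k ⟩
    i
      ∎
    where open ≡-Reasoning

  rank-injective : ∀ {x x' y} → x < n → x' < n → y < n →
                   (c : Chosen (x , y)) (c' : Chosen (x' , y)) → rank c ≡ rank c' → x ≡ x'
  rank-injective _ _ _ (mid-row ¬Mx _) (mid-row ¬Mx' _) eq = squeeze-injective ¬Mx ¬Mx' eq
  rank-injective _ _ _ (mid-column Mx _) (mid-column Mx' _) eq = ∸-cancelʳ-≡ (proj₁ Mx) (proj₁ Mx') eq
  rank-injective {x} {x'} x<n x'<n y<n (off-mid ¬Mx ¬My _) (off-mid ¬Mx' _ _) eq =
    squeeze-injective ¬Mx ¬Mx' (begin
      collapse x              ≡⟨ uncycle-cycle x<n ¬Mx y<n ¬My ⟨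
      uncycle _ (cycle x _)   ≡⟨ cong (uncycle _) eq ⟩
      uncycle _ (cycle x' _)  ≡⟨ uncycle-cycle x'<n ¬Mx' y<n ¬My ⟩
      collapse x'             ∎)
    where open ≡-Reasoning
  rank-injective _ _ _ (mid-column Mx _) (off-mid _ _ m≤c) eq =
    contradiction (subst (m ≤_) (sym eq) m≤c) (<⇒≱ (∸a-< Mx))
  rank-injective _ _ _ (off-mid _ _ m≤c) (mid-column Mx _) eq =
    contradiction (subst (m ≤_) eq m≤c) (<⇒≱ (∸a-< Mx))
  rank-injective _ _ _ (mid-row _ My)     (mid-column _ ¬My) _ = contradiction My ¬My
  rank-injective _ _ _ (mid-row _ My)     (off-mid _ ¬My _)  _ = contradiction My ¬My
  rank-injective _ _ _ (mid-column _ ¬My) (mid-row _ My)     _ = contradiction My ¬My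
  rank-injective _ _ _ (off-mid _ ¬My _)  (mid-row _ My)     _ = contradiction My ¬My

  unrank : ℕ → ℕ → ℕ
  unrank y i with mid? y | i <? m
  ... | yes _ | _     = expand i
  ... | no  _ | yes _ = a + i
  ... | no  _ | no  _ = expand (uncycle y i)

  unrank-< : ∀ {y i} → i < k → unrank y i < n
  unrank-< {y} {i} i<k with mid? y | i <? m
  ... | yes _ | _       = expand-< i<k
  ... | no  _ | yes i<m = <-≤-trans (+-monoʳ-< a i<m) (+-monoˡ-≤ m a≤k)
  ... | no  _ | no  _   = expand-< (m%n<n _ k)

  unrank-chosen : ∀ {y i} → y < n → i < k → Chosen (unrank y i , y)
  unrank-chosen {y} {i} y<n i<k with mid? y | i <? m
  ... | yes My  | _       = mid-row (expand-∉ i) My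
  ... | no  ¬My | yes i<m = mid-column (m≤m+n a i , +-monoʳ-< a i<m) ¬My
  ... | no  ¬My | no  i≮m =
    off-mid (expand-∉ _) ¬My (subst (m ≤_) (sym (cycle-uncycle y<n ¬My i<k)) (≮⇒≥ i≮m))

  rank-unrank : ∀ {y i} (y<n : y < n) (i<k : i < k) → rank (unrank-chosen y<n i<k) ≡ i
  rank-unrank {y} {i} y<n i<k with mid? y | i <? m
  ... | yes _   | _     = squeeze-expand i
  ... | no  _   | yes _ = m+n∸m≡n a i
  ... | no  ¬My | no  _ = cycle-uncycle y<n ¬My i<k

  unrank-injective : ∀ {y i j} → y < n → i < k → j < k → unrank y i ≡ unrank y j → i ≡ j
  unrank-injective {y} {i} {j} y<n i<k j<k eq = begin
    i                             ≡⟨ rank-unrank y<n i<k ⟨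
    rank (unrank-chosen y<n i<k)  ≡⟨ rank-cong eq (unrank-chosen y<n i<k) (unrank-chosen y<n j<k) ⟩
    rank (unrank-chosen y<n j<k)  ≡⟨ rank-unrank y<n j<k ⟩
    j                             ∎
    where open ≡-Reasoning

  point : Fin k → Fin n → Point n
  point i y = fromℕ< (unrank-< {toℕ y} (toℕ<n i)) , y

  point-injective : ∀ {i j y y'} → point i y ≡ point j y' → i ≡ j × y ≡ y'
  point-injective {i} {j} {y} eq with cong proj₂ eq
  ... | refl = toℕ-injective (unrank-injective (toℕ<n y) (toℕ<n i) (toℕ<n j) (begin
    unrank (toℕ y) (toℕ i)            ≡⟨ toℕ-fromℕ< _ ⟨
    toℕ (proj₁ (point i y))           ≡⟨ cong (toℕ ∘ proj₁) eq ⟩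
    toℕ (proj₁ (point j y))           ≡⟨ toℕ-fromℕ< _ ⟩
    unrank (toℕ y) (toℕ j)            ∎)) , refl
    where open ≡-Reasoning

  chosen : List (Point n)
  chosen = cartesianProductWith point (allFin k) (allFin n)

  chosen-length : length chosen ≡ k * n
  chosen-length = trans (length-cartesianProductWith point (allFin k) (allFin n))
                        (cong₂ _*_ (length-tabulate {n = k} id) (length-tabulate {n = n} id))

  chosen-unique : Unique chosen
  chosen-unique =
    Unique.cartesianProductWith⁺ point point-injective (Unique.allFin⁺ k) (Unique.allFin⁺ n)

  chosen-picked : ∀ {p} → p ∈ chosen → Picked (coords p)
  chosen-picked p∈ with ∈-cartesianProductWith⁻ point (allFin k) (allFin n) p∈
  ... | i , y , _ , _ , refl =
    subst (λ x → x < n × toℕ y < n × Chosen (x , toℕ y)) (sym (toℕ-fromℕ< _))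
          (unrank-< (toℕ<n i) , toℕ<n y , unrank-chosen (toℕ<n y) (toℕ<n i))

  rankᵖ : ∀ {p} → Picked p → ℕ
  rankᵖ (_ , _ , c) = rank c

  AtMost-horizontal : ∀ {P} y₀ → (∀ {x y} → P (x , y) → y ≡ y₀) → AtMost k (Picked ∩ P)
  AtMost-horizontal {P} y₀ P⇒y≡y₀ =
    atMostℕ (rankᵖ ∘ proj₁) (λ ((x<n , _ , c) , _) → rank-< x<n c) injective
    where
    injective : ∀ {p q} (pp : (Picked ∩ P) p) (pq : (Picked ∩ P) q) →
                rankᵖ (proj₁ pp) ≡ rankᵖ (proj₁ pq) → p ≡ q
    injective {x , y} {x' , y'} ((x<n , y<n , c) , Pp) ((x'<n , _ , c') , Pq) eq
      with trans (P⇒y≡y₀ Pp) (sym (P⇒y≡y₀ Pq))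
    ... | refl = cong (_, y) (rank-injective x<n x'<n y<n c c' eq)

  AtMost-shallow : ∀ {P} → (∀ {p q} → P p → P q → ⌊ proj₁ p /2⌋ ≡ ⌊ proj₁ q /2⌋ → p ≡ q) →
                   AtMost k (Picked ∩ P)
  AtMost-shallow P-injective = atMostℕ (λ {(x , _)} _ → ⌊ x /2⌋)
    (λ ((x<n , _) , _) → ⌊x/2⌋<N (<-≤-trans x<n (+-monoʳ-≤ k m≤k)))
    (λ (_ , Pp) (_ , Pq) → P-injective Pp Pq)

  AtMost-diagonal : ∀ {P} d → (∀ {x y} → P (x , y) → x ≡ y + d) → AtMost k (Picked ∩ P)
  AtMost-diagonal {P} d P⇒x≡y+d = AtMost-squeeze a (m ∸ d) proj₂ a≤k below outside injective
    where
    below : ∀ {p} → (Picked ∩ P) p → proj₂ p < k + (m ∸ d)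
    below {x , y} ((x<n , _) , Pp) = +-cancelʳ-< d y _ (begin-strict
      y + d               ≡⟨ P⇒x≡y+d Pp ⟨
      x                   <⟨ x<n ⟩
      k + m               ≤⟨ +-monoʳ-≤ k (m≤n+m∸n m d) ⟩
      k + (d + (m ∸ d))   ≡⟨ cong (_+_ k) (+-comm d (m ∸ d)) ⟩
      k + (m ∸ d + d)     ≡⟨ +-assoc k (m ∸ d) d ⟨
      k + (m ∸ d) + d     ∎)
      where open ≤-Reasoning
    Mid² : ∀ {y} → Band a (m ∸ d) y → Mid (y + d) × Mid y
    Mid² {y} y∈@(a≤y , y<a+[m∸d]) with d ≤? m
    ... | yes d≤m = (≤-trans a≤y (m≤m+n y d) , y+d<a+m) , Band-mono (m∸n≤m m d) y∈
      where
      y+d<a+m : y + d < a + m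
      y+d<a+m = subst (y + d <_) (trans (+-assoc a (m ∸ d) d) (cong (_+_ a) (m∸n+n≡m d≤m)))
                      (+-monoˡ-< d y<a+[m∸d])
    ... | no  d≰m = contradiction a≤y (<⇒≱ (subst (y <_) a+[m∸d]≡a y<a+[m∸d]))
      where
      a+[m∸d]≡a : a + (m ∸ d) ≡ a
      a+[m∸d]≡a = trans (cong (_+_ a) (m≤n⇒m∸n≡0 (<⇒≤ (≰⇒> d≰m)))) (+-identityʳ a)
    outside : ∀ {p} → (Picked ∩ P) p → ¬ Band a (m ∸ d) (proj₂ p)
    outside {x , y} ((_ , _ , c) , Pp) y∈ =
      Chosen⇒¬Mid² c (subst Mid (sym (P⇒x≡y+d Pp)) (proj₁ (Mid² y∈)) , proj₂ (Mid² y∈))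
    injective : ∀ {p q} → (Picked ∩ P) p → (Picked ∩ P) q → proj₂ p ≡ proj₂ q → p ≡ q
    injective {x , y} (_ , Pp) (_ , Pq) refl = cong (_, y) (trans (P⇒x≡y+d Pp) (sym (P⇒x≡y+d Pq)))

  module Antidiagonal {P : ℕ × ℕ → Set} (s : ℕ) (P⇒x+y≡s : ∀ {x y} → P (x , y) → x + y ≡ s) where

    injectiveʸ : ∀ {p q} → (Picked ∩ P) p → (Picked ∩ P) q → proj₂ p ≡ proj₂ q → p ≡ q
    injectiveʸ {x , y} {x' , _} (_ , Pp) (_ , Pq) refl =
      cong (_, y) (+-cancelʳ-≡ y x x' (trans (P⇒x+y≡s Pp) (sym (P⇒x+y≡s Pq))))

    injectiveˣ : ∀ {p q} → (Picked ∩ P) p → (Picked ∩ P) q → proj₁ p ≡ proj₁ q → p ≡ q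
    injectiveˣ {x , y} {_ , y'} (_ , Pp) (_ , Pq) refl =
      cong (x ,_) (+-cancelˡ-≡ x y y' (trans (P⇒x+y≡s Pp) (sym (P⇒x+y≡s Pq))))

    short : suc s ≤ k → AtMost k (Picked ∩ P)
    short 1+s≤k = atMostℕ (λ {(_ , y)} _ → y)
      (λ {(x , y)} (_ , Pp) → <-≤-trans (s≤s (subst (y ≤_) (P⇒x+y≡s Pp) (m≤n+m y x))) 1+s≤k)
      injectiveʸ

    corner : n + m ≤ suc s → AtMost k (Picked ∩ P)
    corner n+m≤1+s = atMostℕ (λ {(x , _)} _ → x ∸ m)
      (λ pp@((x<n , _) , _) → +-cancelʳ-< m _ k (subst (_< k + m) (sym (m∸n+n≡m (m≤x pp))) x<n))
      (λ pp pq eq → injectiveˣ pp pq (∸-cancelʳ-≡ (m≤x pp) (m≤x pq) eq))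
      where
      m≤x : ∀ {x y} → (Picked ∩ P) (x , y) → m ≤ x
      m≤x {x} {y} ((_ , y<n , _) , Pp) = +-cancelʳ-≤ (suc y) m x (begin
        m + suc y        ≤⟨ +-monoʳ-≤ m y<n ⟩
        m + n            ≡⟨ +-comm m n ⟩
        n + m            ≤⟨ n+m≤1+s ⟩
        suc s            ≡⟨ cong suc (P⇒x+y≡s Pp) ⟨
        suc (x + y)      ≡⟨ +-suc x y ⟨
        x + suc y        ∎)
        where open ≤-Reasoning

    central : k ≤ suc s → suc s < n → AtMost k (Picked ∩ P)
    central k≤1+s 1+s<n = AtMost-squeeze a (suc s ∸ k) proj₂ a≤k below outside injectiveʸ
      where
      below : ∀ {p} → (Picked ∩ P) p → proj₂ p < k + (suc s ∸ k)
      below {x , y} (_ , Pp) =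
        subst (y <_) (sym (m+[n∸m]≡n k≤1+s)) (s≤s (subst (y ≤_) (P⇒x+y≡s Pp) (m≤n+m y x)))

      outside : ∀ {p} → (Picked ∩ P) p → ¬ Band a (suc s ∸ k) (proj₂ p)
      outside {x , y} ((_ , _ , c) , Pp) y∈@(a≤y , y<a+G) =
        Chosen⇒¬Mid² c ((a≤x , x<a+m) , Band-mono G≤m y∈)
        where
        open ≤-Reasoning
        G≤m : suc s ∸ k ≤ m
        G≤m = subst (suc s ∸ k ≤_) (m+n∸m≡n k m) (∸-monoˡ-≤ k (<⇒≤ 1+s<n))
        y+k≤a+s : y + k ≤ a + s
        y+k≤a+s = s≤s⁻¹ (begin-strict
          y + k                 <⟨ +-monoˡ-< k y<a+G ⟩
          a + (suc s ∸ k) + k   ≡⟨ +-assoc a _ k ⟩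
          a + (suc s ∸ k + k)   ≡⟨ cong (_+_ a) (m∸n+n≡m k≤1+s) ⟩
          a + suc s             ≡⟨ +-suc a s ⟩
          suc (a + s)           ∎)
        a≤x : a ≤ x
        a≤x = +-cancelʳ-≤ y a x (+-cancelʳ-≤ a _ _ (begin
          a + y + a             ≡⟨ solve-ℕ a y ⟩
          y + (a + a)           ≤⟨ +-monoʳ-≤ y a+a≤k ⟩
          y + k                 ≤⟨ y+k≤a+s ⟩
          a + s                 ≡⟨ +-comm a s ⟩
          s + a                 ≡⟨ cong (_+ a) (P⇒x+y≡s Pp) ⟨
          x + y + a             ∎))
          where
          solve-ℕ : ∀ a y → a + y + a ≡ y + (a + a)
          solve-ℕ = solve-∀
        x<a+m : x < a + m
        x<a+m = +-cancelʳ-< y x (a + m) (begin-strict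
          x + y                 ≡⟨ P⇒x+y≡s Pp ⟩
          s                     <⟨ s≤s⁻¹ (<-≤-trans 1+s<n (+-monoˡ-≤ m k≤1+a+a)) ⟩
          a + a + m             ≡⟨ solve-ℕ a m ⟩
          a + m + a             ≤⟨ +-monoʳ-≤ (a + m) a≤y ⟩
          a + m + y             ∎)
          where
          solve-ℕ : ∀ a m → a + a + m ≡ a + m + a
          solve-ℕ = solve-∀

    -- Here suc (collapse x + collapse y) lies in [k, k + m), which is why cycle adds 1.
    cycle<m : ∀ {x y} → x < a → a + m ≤ y → x + y ≡ s → n ≤ suc s → suc s < n + m → cycle x y < m
    cycle<m {x} {y} x<a a+m≤y x+y≡s n≤1+s 1+s<n+m =
      w%k<m m≤k (+-cancelʳ-≤ m k _ (subst (n ≤_) (sym w+m≡1+s) n≤1+s))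
                (+-cancelʳ-< m _ (k + m) (subst (_< n + m) (sym w+m≡1+s) 1+s<n+m))
      where
      open ≡-Reasoning
      w+m≡1+s : suc (collapse x + collapse y) + m ≡ suc s
      w+m≡1+s = cong suc (begin
        collapse x + collapse y + m   ≡⟨ +-assoc (collapse x) (collapse y) m ⟩
        collapse x + (collapse y + m) ≡⟨ cong₂ _+_ (collapse-below x<a) (collapse-above a+m≤y) ⟩
        x + y                         ≡⟨ x+y≡s ⟩
        s                             ∎)

    Chosen⇒Mid⊎Mid : ∀ {x y} → Chosen (x , y) → x + y ≡ s → n ≤ suc s → suc s < n + m → Mid x ⊎ Mid y
    Chosen⇒Mid⊎Mid (mid-row _ My)    _ _ _ = inj₂ My
    Chosen⇒Mid⊎Mid (mid-column Mx _) _ _ _ = inj₁ Mx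
    Chosen⇒Mid⊎Mid {x} {y} (off-mid ¬Mx ¬My m≤c) x+y≡s n≤1+s 1+s<n+m with ∉Mid ¬Mx | ∉Mid ¬My
    ... | inj₁ x<a   | inj₁ y<a   = contradiction n≤1+s (<⇒≱ (begin-strict
      suc s              ≡⟨ cong suc x+y≡s ⟨
      suc x + y          <⟨ +-mono-≤-< x<a y<a ⟩
      a + a              ≤⟨ a+a≤k ⟩
      k                  ≤⟨ m≤m+n k m ⟩
      n                  ∎))
      where open ≤-Reasoning
    ... | inj₂ a+m≤x | inj₂ a+m≤y = contradiction 1+s<n+m (≤⇒≯ (begin
      n + m                 ≤⟨ +-monoˡ-≤ m (+-monoˡ-≤ m k≤1+a+a) ⟩
      suc (a + a) + m + m   ≡⟨ solve-ℕ a m ⟩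
      suc (a + m + (a + m)) ≤⟨ s≤s (+-mono-≤ a+m≤x a+m≤y) ⟩
      suc (x + y)           ≡⟨ cong suc x+y≡s ⟩
      suc s                 ∎))
      where
      open ≤-Reasoning
      solve-ℕ : ∀ a m → suc (a + a) + m + m ≡ suc (a + m + (a + m))
      solve-ℕ = solve-∀
    ... | inj₁ x<a   | inj₂ a+m≤y = contradiction m≤c (<⇒≱ (cycle<m x<a a+m≤y x+y≡s n≤1+s 1+s<n+m))
    ... | inj₂ a+m≤x | inj₁ y<a   = contradiction (subst (m ≤_) (cycle-comm x y) m≤c)
                                      (<⇒≱ (cycle<m y<a a+m≤x (trans (+-comm y x) x+y≡s) n≤1+s 1+s<n+m))

    upper : n ≤ suc s → suc s < n + m → AtMost k (Picked ∩ P)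
    upper n≤1+s 1+s<n+m = atMostℕ (λ {p} _ → index p) index-< index-injective
      where
      Mid⊎Mid : ∀ {p} → (Picked ∩ P) p → Mid (proj₁ p) ⊎ Mid (proj₂ p)
      Mid⊎Mid ((_ , _ , c) , Pp) = Chosen⇒Mid⊎Mid c (P⇒x+y≡s Pp) n≤1+s 1+s<n+m

      index : ℕ × ℕ → ℕ
      index (x , y) with mid? y
      ... | yes _ = y ∸ a
      ... | no  _ = m + (x ∸ a)

      index-< : ∀ {p} → (Picked ∩ P) p → index p < k
      index-< {x , y} pp with mid? y | Mid⊎Mid pp
      ... | yes My  | _        = <-≤-trans (∸a-< My) m≤k
      ... | no  _   | inj₁ Mx  = <-≤-trans (+-monoʳ-< m (∸a-< Mx)) m+m≤k
      ... | no  ¬My | inj₂ My  = contradiction My ¬My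

      index-injective : ∀ {p q} (pp : (Picked ∩ P) p) (pq : (Picked ∩ P) q) → index p ≡ index q → p ≡ q
      index-injective {x , y} {x' , y'} pp pq eq with mid? y | mid? y' | Mid⊎Mid pp | Mid⊎Mid pq
      ... | yes My | yes My' | _ | _ = injectiveʸ pp pq (∸-cancelʳ-≡ (proj₁ My) (proj₁ My') eq)
      ... | yes My | no  _   | _ | _ = contradiction (subst (m ≤_) (sym eq) (m≤m+n m _)) (<⇒≱ (∸a-< My))
      ... | no  _  | yes My' | _ | _ = contradiction (subst (m ≤_) eq (m≤m+n m _)) (<⇒≱ (∸a-< My'))
      ... | no  _  | no  _   | inj₁ Mx | inj₁ Mx' =
        injectiveˣ pp pq (∸-cancelʳ-≡ (proj₁ Mx) (proj₁ Mx') (+-cancelˡ-≡ m _ _ eq))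
      ... | no ¬My | no  _   | inj₂ My | _        = contradiction My ¬My
      ... | no  _  | no ¬My' | _       | inj₂ My' = contradiction My' ¬My'

    AtMost-antidiagonal : AtMost k (Picked ∩ P)
    AtMost-antidiagonal with suc s ≤? k | suc s <? n | suc s <? n + m
    ... | yes 1+s≤k | _         | _           = short 1+s≤k
    ... | no  1+s≰k | yes 1+s<n | _           = central (<⇒≤ (≰⇒> 1+s≰k)) 1+s<n
    ... | no  _     | no  1+s≮n | yes 1+s<n+m = upper (≮⇒≥ 1+s≮n) 1+s<n+m
    ... | no  _     | no  _     | no  1+s≮n+m = corner (≮⇒≥ 1+s≮n+m)

  AtMost-shape : ∀ {P} → Shape P → AtMost k (Picked ∩ P)
  AtMost-shape (horizontal y₀ on)  = AtMost-horizontal y₀ on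
  AtMost-shape (diagonal d on)     = AtMost-diagonal d on
  AtMost-shape (antidiagonal s on) = Antidiagonal.AtMost-antidiagonal s on
  AtMost-shape (shallow on)        = AtMost-shallow on
  AtMost-shape (transposed shape)  =
    AtMost-comap swap (cong swap) (λ (picked , Pp) → Picked-swap picked , Pp) (AtMost-shape shape)

  chosen-admissible : Admissible n k chosen
  chosen-admissible = chosen-unique , λ L → length≤-by-element {xs = filter (onLine? L) chosen}
    λ p∈ → through L (proj₂ (∈-filter⁻ (onLine? L) {xs = chosen} p∈))
    where
    through : ∀ L {p} → OnLine L p → length (filter (onLine? L) chosen) ≤ k
    through L on = AtMost⇒length≤ (Unique.filter⁺ (onLine? L) chosen-unique)
      (∈-filter⁻ (onLine? L) {xs = chosen})
      (AtMost-comap coords coords-injective (λ (q∈ , on) → chosen-picked q∈ , on) (AtMost-shape (shape L on)))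

⌊n/2⌋+⌊n/2⌋≤n : ∀ n → ⌊ n /2⌋ + ⌊ n /2⌋ ≤ n
⌊n/2⌋+⌊n/2⌋≤n n = ≤-trans (+-monoʳ-≤ ⌊ n /2⌋ (⌊n/2⌋≤⌈n/2⌉ n)) (≤-reflexive (⌊n/2⌋+⌈n/2⌉≡n n))

n≤1+⌊n/2⌋+⌊n/2⌋ : ∀ n → n ≤ suc (⌊ n /2⌋ + ⌊ n /2⌋)
n≤1+⌊n/2⌋+⌊n/2⌋ n = begin
  n                       ≡⟨ ⌊n/2⌋+⌈n/2⌉≡n n ⟨
  ⌊ n /2⌋ + ⌈ n /2⌉       ≤⟨ +-monoʳ-≤ ⌊ n /2⌋ (⌊n/2⌋-mono (n≤1+n (suc n))) ⟩
  ⌊ n /2⌋ + suc ⌊ n /2⌋   ≡⟨ +-suc ⌊ n /2⌋ ⌊ n /2⌋ ⟩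
  suc (⌊ n /2⌋ + ⌊ n /2⌋) ∎
  where open ≤-Reasoning

2[k+m]≤3k⇒m+m≤k : ∀ k m → 2 * (k + m) ≤ 3 * k → m + m ≤ k
2[k+m]≤3k⇒m+m≤k k m le = +-cancelˡ-≤ (k + k) (m + m) k (subst₂ _≤_ (double k m) (triple k) le)
  where
  double : ∀ k m → 2 * (k + m) ≡ k + k + (m + m)
  double = solve-∀
  triple : ∀ k → 3 * k ≡ k + k + k
  triple = solve-∀

lower-bound : ∀ n k → 2 * n ≤ 3 * k → k ≤ n → ∃ λ S → Admissible n k S × length S ≡ k * n
lower-bound n 0         _     _   = [] , ([] , λ _ → z≤n) , refl
lower-bound n k@(suc _) 2n≤3k k≤n = subst (λ N → ∃ λ S → Admissible N k S × length S ≡ k * N) k+m≡n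
  (chosen , chosen-admissible , chosen-length)
  where
  m : ℕ
  m = n ∸ k
  k+m≡n : k + m ≡ n
  k+m≡n = m+[n∸m]≡n k≤n
  m+m≤k : m + m ≤ k
  m+m≤k = 2[k+m]≤3k⇒m+m≤k k m (subst (λ N → 2 * N ≤ 3 * k) (sym k+m≡n) 2n≤3k)
  open Construction k m ⌊ k /2⌋ m+m≤k (⌊n/2⌋+⌊n/2⌋≤n k) (n≤1+⌊n/2⌋+⌊n/2⌋ k)

proposition3p1 : (n k : ℕ) → 2 * n ≤ 3 * k → k ≤ n → IsFkn k n (k * n)
proposition3p1 n k 2n≤3k k≤n = lower-bound n k 2n≤3k k≤n , λ S → Admissible⇒length≤
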